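{- Let $(P,\le,*)$ be a relatively pseudocomplemented poset, $D$ a deductive system of $(P,\le,*)$ and $\Theta$ a congruence on $(P,\le,*)$. Then $D$ is a filter of $(P,\le,*)$ and $[1]\Theta$ is a strong filter of $(P,\le,*)$.
   Context: For a poset $(P,\le)$ and $x,y\in P$ let $L(x,y)=\{z\in P\mid z\le x,\ z\le y\}$ and $U(x,y)=\{z\in P\mid x\le z,\ y\le z\}$; $\operatorname{Max}A$, $\operatorname{Min}A$ are the sets of maximal, minimal elements of $A$. A poset is relatively pseudocomplemented if for all $x,y\in P$ there exists a greatest element $z$ of $P$ such that every element of $L(x,z)$ is $\le y$; this $z$ is denoted $x*y$; such a poset has a greatest element $1$. A binary relation $R$ is compatible with a map $Q\colon P^2\to 2^P$ if whenever $(a_1,b_1),(a_2,b_2)\in R$ there exist $a\in Q(a_1,a_2)$, $b\in Q(b_1,b_2)$ with $(a,b)\in R$. A congruence on $(P,\le,*)$ is an equivalence relation compatible with $(x,y)\mapsto\operatorname{Max}L(x,y)$, $(x,y)\mapsto\operatorname{Min}U(x,y)$, and with $*$. A deductive system is a subset $D$ with $1\in D$ such that $x\in D$, $y\in P$, $x*y\in D$ imply $y\in D$. A filter of $(P,\le)$ is a nonempty upward closed subset $F$; it is strong if $L(x,y)\cap F\ne\emptyset$ for all $x,y\in F$. A filter of $(P,\le,*)$ is a filter $F$ of $(P,\le)$ with $x*y\in F$ for all $x,y\in F$; it is strong if it is moreover a strong filter of $(P,\le)$. -}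

module Defs where

open import Level using (Level; _⊔_; suc)
open import Data.Product using (Σ; _×_; ∃; ∃-syntax)
open import Relation.Binary.Core using (Rel)
open import Relation.Binary.Structures using (IsPartialOrder; IsEquivalence)
open import Relation.Binary.PropositionalEquality using (_≡_)
open import Relation.Unary using (Pred)

record RPCPoset (a ℓ : Level) : Set (Level.suc (a ⊔ ℓ)) where
  infix 4 _≤_
  infixr 6 _*_
  field
    Carrier        : Set a
    _≤_            : Rel Carrier ℓ
    isPartialOrder : IsPartialOrder _≡_ _≤_
    _*_            : Carrier → Carrier → Carrier
    *-lower        : ∀ x y w → w ≤ x → w ≤ x * y → w ≤ y
    *-greatest     : ∀ x y z → (∀ w → w ≤ x → w ≤ z → w ≤ y) → z ≤ x * y
    𝟏              : Carrier
    ≤-𝟏            : ∀ x → x ≤ 𝟏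

module _ {a ℓ : Level} (P : RPCPoset a ℓ) where
  open RPCPoset P

  L : Carrier → Carrier → Pred Carrier ℓ
  L x y z = z ≤ x × z ≤ y

  U : Carrier → Carrier → Pred Carrier ℓ
  U x y z = x ≤ z × y ≤ z

  Max : ∀ {p} → Pred Carrier p → Pred Carrier (a ⊔ ℓ ⊔ p)
  Max A z = A z × (∀ w → A w → z ≤ w → w ≡ z)

  Min : ∀ {p} → Pred Carrier p → Pred Carrier (a ⊔ ℓ ⊔ p)
  Min A z = A z × (∀ w → A w → w ≤ z → w ≡ z)

  MaxL : Carrier → Carrier → Pred Carrier (a ⊔ ℓ)
  MaxL x y = Max (L x y)

  MinU : Carrier → Carrier → Pred Carrier (a ⊔ ℓ)
  MinU x y = Min (U x y)

  -- the operation * viewed as a map P² → 2^P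
  StarQ : Carrier → Carrier → Pred Carrier a
  StarQ x y z = z ≡ x * y

  Compatible : ∀ {r q} → Rel Carrier r → (Carrier → Carrier → Pred Carrier q) → Set (a ⊔ r ⊔ q)
  Compatible R Q = ∀ a₁ b₁ a₂ b₂ → R a₁ b₁ → R a₂ b₂ →
                   ∃[ x ] ∃[ y ] (Q a₁ a₂ x × Q b₁ b₂ y × R x y)

  record IsCongruence {r} (Θ : Rel Carrier r) : Set (a ⊔ ℓ ⊔ r) where
    field
      isEquivalence : IsEquivalence Θ
      compat-MaxL   : Compatible Θ MaxL
      compat-MinU   : Compatible Θ MinU
      compat-*      : Compatible Θ StarQ

  record IsDeductiveSystem {d} (D : Pred Carrier d) : Set (a ⊔ d) where
    field
      𝟏∈D : D 𝟏
      mp  : ∀ x y → D x → D (x * y) → D y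

  record IsPosetFilter {f} (F : Pred Carrier f) : Set (a ⊔ ℓ ⊔ f) where
    field
      nonempty : ∃[ x ] F x
      upward   : ∀ x y → F x → x ≤ y → F y

  record IsStrongPosetFilter {f} (F : Pred Carrier f) : Set (a ⊔ ℓ ⊔ f) where
    field
      isPosetFilter : IsPosetFilter F
      strong        : ∀ x y → F x → F y → ∃[ z ] (L x y z × F z)

  record IsFilter {f} (F : Pred Carrier f) : Set (a ⊔ ℓ ⊔ f) where
    field
      isPosetFilter : IsPosetFilter F
      *-closed      : ∀ x y → F x → F y → F (x * y)

  record IsStrongFilter {f} (F : Pred Carrier f) : Set (a ⊔ ℓ ⊔ f) where
    field
      isFilter : IsFilter F
      strong   : ∀ x y → F x → F y → ∃[ z ] (L x y z × F z)

  classOf𝟏 : ∀ {r} → Rel Carrier r → Pred Carrier r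
  classOf𝟏 Θ x = Θ x 𝟏

{-# OPTIONS --safe #-}
-- Both parts reduce to upward closure, since y ≤ x * y makes every upward
-- closed set containing y contain x * y. A deductive system is upward closed
-- because x ≤ y forces x * y = 1. For [1]Θ, compatibility with Min U applied
-- to x Θ 1 and y Θ y relates Min U(x,y) = {y} to Min U(1,y) = {1} when x ≤ y;
-- applied to x Θ 1 and y Θ 1, compatibility with Max L relates some lower
-- bound of x and y to the only element 1 of Max L(1,1).
module Submission where

open import Defs
open import Level using (Level; _⊔_)
open import Relation.Binary.Core using (Rel)
open import Relation.Binary.Definitions using (Reflexive)
open import Relation.Binary.Structures using (IsPartialOrder; IsEquivalence)
open import Relation.Unary using (Pred)
open import Data.Product using (_×_; _,_; ∃-syntax)
open import Relation.Binary.PropositionalEquality using (_≡_; sym; subst)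

module _ {a ℓ : Level} (P : RPCPoset a ℓ) where
  open RPCPoset P
  open IsPartialOrder isPartialOrder using (antisym; trans) renaming (refl to ≤-refl)

  UpwardClosed : ∀ {f} → Pred Carrier f → Set (a ⊔ ℓ ⊔ f)
  UpwardClosed F = ∀ x y → F x → x ≤ y → F y

  ≤⇒*≡𝟏 : ∀ {x y} → x ≤ y → x * y ≡ 𝟏
  ≤⇒*≡𝟏 {x} {y} x≤y = antisym (≤-𝟏 _) (*-greatest x y 𝟏 (λ w w≤x _ → trans w≤x x≤y))

  y≤x*y : ∀ x y → y ≤ x * y
  y≤x*y x y = *-greatest x y y (λ _ _ w≤y → w≤y)

  MaxL-≤ : ∀ {x y v} → x ≤ y → MaxL P x y v → v ≡ x
  MaxL-≤ x≤y ((v≤x , _) , maximal) = sym (maximal _ (≤-refl , x≤y) v≤x)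

  MinU-≤ : ∀ {x y u} → x ≤ y → MinU P x y u → u ≡ y
  MinU-≤ x≤y ((_ , y≤u) , minimal) = sym (minimal _ (x≤y , ≤-refl) y≤u)

  MinU-≥ : ∀ {x y u} → y ≤ x → MinU P x y u → u ≡ x
  MinU-≥ y≤x ((x≤u , _) , minimal) = sym (minimal _ (≤-refl , y≤x) x≤u)

  upwardClosed⇒IsFilter : ∀ {f} {F : Pred Carrier f} → F 𝟏 → UpwardClosed F → IsFilter P F
  upwardClosed⇒IsFilter F𝟏 up = record
    { isPosetFilter = record { nonempty = 𝟏 , F𝟏 ; upward = up }
    ; *-closed      = λ x y _ Fy → up y (x * y) Fy (y≤x*y x y)
    }

  deductiveSystem-upwardClosed : ∀ {d} {D : Pred Carrier d} →
                                 IsDeductiveSystem P D → UpwardClosed D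
  deductiveSystem-upwardClosed {D = D} ds x y Dx x≤y =
    mp x y Dx (subst D (sym (≤⇒*≡𝟏 x≤y)) 𝟏∈D)
    where open IsDeductiveSystem ds

  deductiveSystem⇒IsFilter : ∀ {d} {D : Pred Carrier d} → IsDeductiveSystem P D → IsFilter P D
  deductiveSystem⇒IsFilter ds =
    upwardClosed⇒IsFilter (IsDeductiveSystem.𝟏∈D ds) (deductiveSystem-upwardClosed ds)

  module _ {r} {Θ : Rel Carrier r} where

    classOf𝟏-upwardClosed : Reflexive Θ → Compatible P Θ (MinU P) → UpwardClosed (classOf𝟏 P Θ)
    classOf𝟏-upwardClosed Θ-refl compat x y xΘ𝟏 x≤y
      with compat x 𝟏 y y xΘ𝟏 Θ-refl
    ... | u , v , u∈MinUxy , v∈MinU𝟏y , uΘv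
      rewrite MinU-≤ x≤y u∈MinUxy | MinU-≥ (≤-𝟏 y) v∈MinU𝟏y = uΘv

    classOf𝟏-strong : Compatible P Θ (MaxL P) →
                      ∀ x y → Θ x 𝟏 → Θ y 𝟏 → ∃[ z ] (L P x y z × Θ z 𝟏)
    classOf𝟏-strong compat x y xΘ𝟏 yΘ𝟏
      with compat x 𝟏 y 𝟏 xΘ𝟏 yΘ𝟏
    ... | u , v , (u∈Lxy , _) , v∈MaxL𝟏𝟏 , uΘv
      rewrite MaxL-≤ ≤-refl v∈MaxL𝟏𝟏 = u , u∈Lxy , uΘv

    congruence⇒classOf𝟏-IsStrongFilter : IsCongruence P Θ → IsStrongFilter P (classOf𝟏 P Θ)
    congruence⇒classOf𝟏-IsStrongFilter cg = record
      { isFilter = upwardClosed⇒IsFilter Θ-refl (classOf𝟏-upwardClosed Θ-refl compat-MinU)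
      ; strong   = classOf𝟏-strong compat-MaxL
      }
      where
      open IsCongruence cg
      Θ-refl : Reflexive Θ
      Θ-refl = IsEquivalence.refl isEquivalence

lemma4p12 : ∀ {a ℓ d r : Level} (P : RPCPoset a ℓ)
    (D : Pred (RPCPoset.Carrier P) d) (Θ : Rel (RPCPoset.Carrier P) r) →
    IsDeductiveSystem P D → IsCongruence P Θ →
    IsFilter P D × IsStrongFilter P (classOf𝟏 P Θ)
lemma4p12 P D Θ ds cg =
  deductiveSystem⇒IsFilter P ds , congruence⇒classOf𝟏-IsStrongFilter P cg
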